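{- Let $T$ be a tournament on strategies $\{1,\dots,n\}$, viewed as a Rock Paper Scissors variant. If $\vec a$ is a Nash equilibrium and $c_j(\vec a)=1$ for all $1\le j\le n$, then every $a_j$ is a rational number which, written in lowest terms as $p_j/q_j$, has both $p_j$ and $q_j$ odd.
   Context: A Rock Paper Scissors variant is given by a tournament on strategies $\{1,\dots,n\}$: for distinct $i,j$ exactly one of "$i$ beats $j$" or "$j$ beats $i$" holds. Define $g_{ij}=2$ if $i$ beats $j$, $g_{ii}=1$, and $g_{ij}=0$ if $j$ beats $i$. A strategy profile is a vector $\vec a$ with $a_i\ge 0$ and $\sum_i a_i=1$. A Nash equilibrium is a strategy profile $\vec a$ such that for every strategy profile $\vec b$, $\sum_{i,j} g_{ij}a_ib_j\ge 1$. For a strategy profile $\vec a$, $c_j(\vec a)=\sum_{i=1}^n g_{ij}a_i$. -}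

module Defs where

open import Level using (Level; _⊔_) renaming (suc to lsuc)
open import Algebra.Bundles using (CommutativeRing)
open import Relation.Binary.Structures using (IsTotalOrder)
open import Relation.Binary.PropositionalEquality using (_≡_; _≢_)
open import Relation.Nullary using (¬_; yes; no)
open import Data.Bool using (Bool; true; false; not; if_then_else_)
open import Data.Fin using (Fin; zero; suc; _≟_)
open import Data.Nat as ℕ using (ℕ)
open import Data.Integer as ℤ using (ℤ; +_; -[1+_])
open import Data.Product using (Σ; ∃; _×_)

-- An ordered field (the paper works over ℝ; we work over an arbitrary
-- ordered field).
record OrderedField (c ℓ₁ ℓ₂ : Level) : Set (lsuc (c ⊔ ℓ₁ ⊔ ℓ₂)) where
  field
    commRing : CommutativeRing c ℓ₁
  open CommutativeRing commRing public
  field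
    _≤_           : Carrier → Carrier → Set ℓ₂
    isTotalOrder  : IsTotalOrder _≈_ _≤_
    +-mono-≤      : ∀ {x y} z → x ≤ y → (x + z) ≤ (y + z)
    *-nonneg      : ∀ {x y} → 0# ≤ x → 0# ≤ y → 0# ≤ (x * y)
    0≉1           : ¬ (0# ≈ 1#)
    inverse       : ∀ x → ¬ (x ≈ 0#) → Σ Carrier (λ y → (x * y) ≈ 1#)

IsTournament : (n : ℕ) → (Fin n → Fin n → Bool) → Set
IsTournament n beats = ∀ (i j : Fin n) → i ≢ j → beats i j ≡ not (beats j i)

module _ {c ℓ₁ ℓ₂} (F : OrderedField c ℓ₁ ℓ₂) where
  open OrderedField F using (Carrier; _≈_; _+_; _*_; -_; 0#; 1#; _≤_)

  ∑ : (n : ℕ) → (Fin n → Carrier) → Carrier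
  ∑ ℕ.zero    f = 0#
  ∑ (ℕ.suc n) f = f zero + ∑ n (λ i → f (suc i))

  fromℕ : ℕ → Carrier
  fromℕ ℕ.zero    = 0#
  fromℕ (ℕ.suc m) = 1# + fromℕ m

  fromℤ : ℤ → Carrier
  fromℤ (+ m)      = fromℕ m
  fromℤ -[1+ m ]   = - (fromℕ (ℕ.suc m))

  payoff : {n : ℕ} → (Fin n → Fin n → Bool) → Fin n → Fin n → Carrier
  payoff beats i j with i ≟ j
  ... | yes _ = 1#
  ... | no  _ = if beats i j then (1# + 1#) else 0#

  IsProfile : (n : ℕ) → (Fin n → Carrier) → Set (ℓ₁ ⊔ ℓ₂)
  IsProfile n a = (∀ i → 0# ≤ a i) × (∑ n a ≈ 1#)

  IsNash : (n : ℕ) → (Fin n → Fin n → Bool) → (Fin n → Carrier) → Set (c ⊔ ℓ₁ ⊔ ℓ₂)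
  IsNash n beats a =
    IsProfile n a ×
    (∀ (b : Fin n → Carrier) → IsProfile n b →
       1# ≤ ∑ n (λ i → ∑ n (λ j → (payoff beats i j * a i) * b j)))

  cj : (n : ℕ) → (Fin n → Fin n → Bool) → (Fin n → Carrier) → Fin n → Carrier
  cj n beats a j = ∑ n (λ i → payoff beats i j * a i)

{-# OPTIONS --safe #-}

-- Only the hypothesis c_j(a) = 1 is used: it says that a solves the integer
-- system gᵀ a = 1, whose matrix is the identity modulo 2 (g_ii = 1, and
-- g_ij ∈ {0, 2} otherwise).  For any system M x = r with M ≡ I (mod k),
-- eliminating x₀ without division (Chiò condensation: the new entries are the
-- minors M₀₀ M_ij − M_i0 M_0j) leaves a smaller system of the same kind whose
-- right-hand side is ≡ r, so by induction d x = p with integers d ≡ 1 and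
-- p ≡ r (mod k).  For k = 2 and r = 1 both d and p are odd, and dividing them by
-- their gcd keeps them odd; the division is legitimate in F because an ordered
-- field has characteristic 0.

module Submission where

open import Function using (_∘_)
open import Data.Bool using (Bool; true; false; if_then_else_)
open import Data.Empty using (⊥-elim)
open import Data.Fin using (Fin; zero; suc; _≟_)
import Data.Maybe as Maybe
open import Data.Nat as ℕ using (ℕ; NonZero; _%_; _/_)
import Data.Nat.Divisibility as ℕ
open import Data.Nat.DivMod using (m%n<n; m/n*n≡m; m*n/n≡m)
open import Data.Nat.GCD using (gcd; gcd[m,n]∣m; gcd[m,n]∣n; gcd[m,n]≢0)
open import Data.Nat.Coprimality using (Coprime; coprime-/gcd)
open import Data.Integer as ℤ using (ℤ; +_; -[1+_]; +[1+_]; ∣_∣; sign; _◃_; _⊖_)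
import Data.Integer.Properties as ℤ
open import Data.Integer.Divisibility.Signed
  using (_∣_; divides; ∣ᵤ⇒∣; ∣⇒∣ᵤ; ∣m⇒∣m*n; ∣m⇒∣-m; ∣m∣n⇒∣m+n; ∣m∣n⇒∣m-n)
import Data.Integer.Tactic.RingSolver as ℤ-Solver
open import Data.Sign as Sign using (Sign)
open import Data.Product using (Σ; _×_; _,_)
open import Data.Sum using (inj₁; inj₂)
open import Relation.Binary.PropositionalEquality as ≡ using (_≡_)
open import Relation.Binary.Structures using (IsTotalOrder)
open import Relation.Nullary using (¬_; yes; no; does; contradiction)
open import Relation.Nullary.Decidable using (dec⇒maybe)
open import Algebra.Properties.Monoid.Sum ℤ.+-0-monoid using () renaming (sum to sumℤ)
import Algebra.Solver.Ring.AlmostCommutativeRing as ACR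
open import Defs

infix 4 _≡_[mod_]

-- A record rather than a definition, so that i, j and k can be inferred.
record _≡_[mod_] (i j k : ℤ) : Set where
  constructor ∣⇒≡
  field ≡⇒∣ : k ∣ i ℤ.- j

δ : ∀ {n} → Fin n → Fin n → ℤ
δ i j = if does (i ≟ j) then + 1 else + 0

δ-sym : ∀ {n} (i j : Fin n) → δ i j ≡ δ j i
δ-sym i j with i ≟ j | j ≟ i
... | yes _   | yes _   = ≡.refl
... | no _    | no _    = ≡.refl
... | yes i≡j | no j≢i  = ⊥-elim (j≢i (≡.sym i≡j))
... | no i≢j  | yes j≡i = ⊥-elim (i≢j (≡.sym j≡i))

module _ {k : ℤ} where

  ≡-mod-refl : ∀ {i} → i ≡ i [mod k ]
  ≡-mod-refl {i} = ∣⇒≡ (divides (+ 0) (ℤ.+-inverseʳ i))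

  ≡-mod-trans : ∀ {i j l} → i ≡ j [mod k ] → j ≡ l [mod k ] → i ≡ l [mod k ]
  ≡-mod-trans {i} {j} {l} (∣⇒≡ k∣i-j) (∣⇒≡ k∣j-l) =
    ∣⇒≡ (≡.subst (k ∣_) (telescope i j l) (∣m∣n⇒∣m+n k∣i-j k∣j-l))
    where
    telescope : ∀ i j l → (i ℤ.- j) ℤ.+ (j ℤ.- l) ≡ i ℤ.- l
    telescope = ℤ-Solver.solve-∀

  ≡0⇒∣ : ∀ {i} → i ≡ + 0 [mod k ] → k ∣ i
  ≡0⇒∣ {i} (∣⇒≡ k∣i-0) = ≡.subst (k ∣_) (ℤ.+-identityʳ i) k∣i-0

  ≡1⇒*≡ : ∀ {a} b → a ≡ + 1 [mod k ] → a ℤ.* b ≡ b [mod k ]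
  ≡1⇒*≡ {a} b (∣⇒≡ k∣a-1) = ∣⇒≡ (≡.subst (k ∣_) (identity a b) (∣m⇒∣m*n b k∣a-1))
    where
    identity : ∀ a b → (a ℤ.- + 1) ℤ.* b ≡ a ℤ.* b ℤ.- b
    identity = ℤ-Solver.solve-∀

  ∣⇒-≡ : ∀ {c} b → k ∣ c → b ℤ.- c ≡ b [mod k ]
  ∣⇒-≡ {c} b k∣c = ∣⇒≡ (≡.subst (k ∣_) (identity b c) (∣m⇒∣-m k∣c))
    where
    identity : ∀ b c → ℤ.- c ≡ (b ℤ.- c) ℤ.- b
    identity = ℤ-Solver.solve-∀

  ∣-sum : ∀ {n} (f : Fin n → ℤ) → (∀ i → k ∣ f i) → k ∣ sumℤ f
  ∣-sum {ℕ.zero}  f _   = divides (+ 0) ≡.refl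
  ∣-sum {ℕ.suc n} f k∣f = ∣m∣n⇒∣m+n (k∣f zero) (∣-sum (f ∘ suc) (k∣f ∘ suc))

  condensation-≡ : ∀ {a c} b d → a ≡ + 1 [mod k ] → c ≡ + 0 [mod k ] →
                   a ℤ.* d ℤ.- c ℤ.* b ≡ d [mod k ]
  condensation-≡ b d a≡1 c≡0 = ≡-mod-trans (∣⇒-≡ _ (∣m⇒∣m*n b (≡0⇒∣ c≡0))) (≡1⇒*≡ d a≡1)

condense : ∀ {n} → (Fin (ℕ.suc n) → Fin (ℕ.suc n) → ℤ) → Fin n → Fin n → ℤ
condense M i j = M zero zero ℤ.* M (suc i) (suc j) ℤ.- M (suc i) zero ℤ.* M zero (suc j)

condenseRhs : ∀ {n} → (Fin (ℕ.suc n) → Fin (ℕ.suc n) → ℤ) → (Fin (ℕ.suc n) → ℤ) → Fin n → ℤ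
condenseRhs M r i = M zero zero ℤ.* r (suc i) ℤ.- M (suc i) zero ℤ.* r zero

module _ {k : ℤ} {n} {M : Fin (ℕ.suc n) → Fin (ℕ.suc n) → ℤ}
         (M≡I : ∀ i j → M i j ≡ δ i j [mod k ]) where

  condense-≡δ : ∀ i j → condense M i j ≡ δ i j [mod k ]
  condense-≡δ i j =
    ≡-mod-trans (condensation-≡ _ _ (M≡I zero zero) (M≡I (suc i) zero)) (M≡I (suc i) (suc j))

  condenseRhs-≡ : ∀ r i → condenseRhs M r i ≡ r (suc i) [mod k ]
  condenseRhs-≡ r i = condensation-≡ _ _ (M≡I zero zero) (M≡I (suc i) zero)

≡1-mod-2⇒odd : ∀ {i} → i ≡ + 1 [mod + 2 ] → ¬ 2 ℕ.∣ ∣ i ∣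
≡1-mod-2⇒odd {i} (∣⇒≡ 2∣i-1) 2∣i =
  contradiction (ℕ.∣1⇒≡1 (∣⇒∣ᵤ 2∣1)) λ ()
  where
  identity : ∀ i → i ℤ.- (i ℤ.- + 1) ≡ + 1
  identity = ℤ-Solver.solve-∀

  2∣1 : + 2 ∣ + 1
  2∣1 = ≡.subst (+ 2 ∣_) (identity i) (∣m∣n⇒∣m-n (∣ᵤ⇒∣ {+ 2} {i} 2∣i) 2∣i-1)

¬∣⇒NonZero : ∀ {d n} → ¬ d ℕ.∣ n → NonZero n
¬∣⇒NonZero {d} {ℕ.zero}  d∤0 = contradiction (d ℕ.∣0) d∤0
¬∣⇒NonZero {d} {ℕ.suc n} _   = _

odd⇒%2≡1 : ∀ {n} → ¬ 2 ℕ.∣ n → n % 2 ≡ 1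
odd⇒%2≡1 {n} odd with n % 2 in n%2≡r | m%n<n n 2
... | 0           | _                   = contradiction (ℕ.m%n≡0⇒n∣m n 2 n%2≡r) odd
... | 1           | _                   = ≡.refl
... | ℕ.suc (ℕ.suc _) | ℕ.s≤s (ℕ.s≤s ())

¬∣m*n⇒¬∣m : ∀ {d m} n → ¬ d ℕ.∣ m ℕ.* n → ¬ d ℕ.∣ m
¬∣m*n⇒¬∣m n d∤mn d∣m = d∤mn (ℕ.∣m⇒∣m*n n d∣m)

payoffℤ : ∀ {n} → (Fin n → Fin n → Bool) → Fin n → Fin n → ℤ
payoffℤ beats i j with i ≟ j
... | yes _ = + 1
... | no  _ = if beats i j then + 2 else + 0

payoffℤ-≡δ : ∀ {n} beats (i j : Fin n) → payoffℤ beats i j ≡ δ i j [mod + 2 ]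
payoffℤ-≡δ beats i j with i ≟ j
... | yes _ = ≡-mod-refl
... | no  _ with beats i j
...   | true  = ∣⇒≡ (divides (+ 1) ≡.refl)
...   | false = ≡-mod-refl

payoffℤᵀ-≡δ : ∀ {n} beats (i j : Fin n) → payoffℤ beats j i ≡ δ i j [mod + 2 ]
payoffℤᵀ-≡δ beats i j =
  ≡.subst (λ t → payoffℤ beats j i ≡ t [mod + 2 ]) (δ-sym j i) (payoffℤ-≡δ beats j i)

module _ {c ℓ₁ ℓ₂} (F : OrderedField c ℓ₁ ℓ₂) where

  open OrderedField F hiding (zero)
  open import Relation.Binary.Reasoning.Setoid setoid
  open import Algebra.Properties.Ring ring using (-0#≈0#; -1*x≈-x; -‿involutive; -‿distribˡ-*)
  open import Algebra.Properties.AbelianGroup +-abelianGroup using (⁻¹-∙-comm)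
  open import Algebra.Properties.CommutativeSemigroup +-commutativeSemigroup
    using () renaming (interchange to +-interchange)
  open import Algebra.Properties.CommutativeSemigroup *-commutativeSemigroup
    using (x∙yz≈y∙xz) renaming (interchange to *-interchange)
  open import Algebra.Properties.Semiring.Mult semiring using (×-homo-+; ×1-homo-*)
    renaming (_×_ to _·_)

  ⟦_⟧ : ℤ → Carrier
  ⟦_⟧ = fromℤ F

  fromℕ≡· : ∀ m → fromℕ F m ≡ m · 1#
  fromℕ≡· ℕ.zero    = ≡.refl
  fromℕ≡· (ℕ.suc m) = ≡.cong (λ x → 1# + x) (fromℕ≡· m)

  fromℕ-+ : ∀ m n → ⟦ + (m ℕ.+ n) ⟧ ≈ ⟦ + m ⟧ + ⟦ + n ⟧
  fromℕ-+ m n rewrite fromℕ≡· (m ℕ.+ n) | fromℕ≡· m | fromℕ≡· n = ×-homo-+ 1# m n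

  fromℕ-* : ∀ m n → ⟦ + (m ℕ.* n) ⟧ ≈ ⟦ + m ⟧ * ⟦ + n ⟧
  fromℕ-* m n rewrite fromℕ≡· (m ℕ.* n) | fromℕ≡· m | fromℕ≡· n = ×1-homo-* m n

  fromℤ-neg : ∀ i → ⟦ ℤ.- i ⟧ ≈ - ⟦ i ⟧
  fromℤ-neg (+ ℕ.zero) = sym -0#≈0#
  fromℤ-neg +[1+ n ]   = refl
  fromℤ-neg -[1+ n ]   = sym (-‿involutive _)

  fromℤ-⊖ : ∀ m n → ⟦ m ⊖ n ⟧ ≈ ⟦ + m ⟧ - ⟦ + n ⟧
  fromℤ-⊖ m         ℕ.zero    = sym (trans (+-congˡ -0#≈0#) (+-identityʳ _))
  fromℤ-⊖ ℕ.zero    (ℕ.suc n) = sym (+-identityˡ _)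
  fromℤ-⊖ (ℕ.suc m) (ℕ.suc n) = begin
    ⟦ ℕ.suc m ⊖ ℕ.suc n ⟧           ≡⟨ ≡.cong ⟦_⟧ (ℤ.[1+m]⊖[1+n]≡m⊖n m n) ⟩
    ⟦ m ⊖ n ⟧                       ≈⟨ fromℤ-⊖ m n ⟩
    ⟦ + m ⟧ - ⟦ + n ⟧               ≈⟨ +-identityˡ _ ⟨
    0# + (⟦ + m ⟧ - ⟦ + n ⟧)        ≈⟨ +-congʳ (-‿inverseʳ 1#) ⟨
    (1# - 1#) + (⟦ + m ⟧ - ⟦ + n ⟧) ≈⟨ +-interchange _ _ _ _ ⟩
    (1# + ⟦ + m ⟧) + (- 1# - ⟦ + n ⟧) ≈⟨ +-congˡ (⁻¹-∙-comm _ _) ⟩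
    ⟦ + ℕ.suc m ⟧ - ⟦ + ℕ.suc n ⟧   ∎

  fromℤ-+ : ∀ i j → ⟦ i ℤ.+ j ⟧ ≈ ⟦ i ⟧ + ⟦ j ⟧
  fromℤ-+ (+ m)    (+ n)    = fromℕ-+ m n
  fromℤ-+ (+ m)    -[1+ n ] = fromℤ-⊖ m (ℕ.suc n)
  fromℤ-+ -[1+ m ] (+ n)    = trans (fromℤ-⊖ n (ℕ.suc m)) (+-comm _ _)
  fromℤ-+ -[1+ m ] -[1+ n ] = begin
    ⟦ -[1+ m ] ℤ.+ -[1+ n ] ⟧             ≡⟨ ≡.cong ⟦_⟧ (ℤ.neg-distrib-+ +[1+ m ] +[1+ n ]) ⟨
    ⟦ ℤ.- (+[1+ m ] ℤ.+ +[1+ n ]) ⟧       ≈⟨ fromℤ-neg (+[1+ m ] ℤ.+ +[1+ n ]) ⟩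
    - ⟦ +[1+ m ] ℤ.+ +[1+ n ] ⟧           ≈⟨ -‿cong (fromℕ-+ (ℕ.suc m) (ℕ.suc n)) ⟩
    - (⟦ +[1+ m ] ⟧ + ⟦ +[1+ n ] ⟧)       ≈⟨ ⁻¹-∙-comm _ _ ⟨
    ⟦ -[1+ m ] ⟧ + ⟦ -[1+ n ] ⟧           ∎

  fromSign : Sign → Carrier
  fromSign Sign.+ = 1#
  fromSign Sign.- = - 1#

  fromSign-* : ∀ s t → fromSign (s Sign.* t) ≈ fromSign s * fromSign t
  fromSign-* Sign.+ t      = sym (*-identityˡ _)
  fromSign-* Sign.- Sign.+ = sym (*-identityʳ _)
  fromSign-* Sign.- Sign.- = sym (trans (-1*x≈-x _) (-‿involutive _))

  fromℤ-◃ : ∀ s n → ⟦ s ◃ n ⟧ ≈ fromSign s * ⟦ + n ⟧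
  fromℤ-◃ s      ℕ.zero    = sym (zeroʳ _)
  fromℤ-◃ Sign.+ (ℕ.suc n) = sym (*-identityˡ _)
  fromℤ-◃ Sign.- (ℕ.suc n) = sym (-1*x≈-x _)

  fromℤ-* : ∀ i j → ⟦ i ℤ.* j ⟧ ≈ ⟦ i ⟧ * ⟦ j ⟧
  fromℤ-* i j = begin
    ⟦ sign i Sign.* sign j ◃ ∣ i ∣ ℕ.* ∣ j ∣ ⟧
      ≈⟨ fromℤ-◃ (sign i Sign.* sign j) (∣ i ∣ ℕ.* ∣ j ∣) ⟩
    fromSign (sign i Sign.* sign j) * ⟦ + (∣ i ∣ ℕ.* ∣ j ∣) ⟧
      ≈⟨ *-cong (fromSign-* (sign i) (sign j)) (fromℕ-* ∣ i ∣ ∣ j ∣) ⟩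
    (fromSign (sign i) * fromSign (sign j)) * (⟦ + ∣ i ∣ ⟧ * ⟦ + ∣ j ∣ ⟧)
      ≈⟨ *-interchange _ _ _ _ ⟩
    (fromSign (sign i) * ⟦ + ∣ i ∣ ⟧) * (fromSign (sign j) * ⟦ + ∣ j ∣ ⟧)
      ≈⟨ *-cong (fromℤ-◃ (sign i) ∣ i ∣) (fromℤ-◃ (sign j) ∣ j ∣) ⟨
    ⟦ sign i ◃ ∣ i ∣ ⟧ * ⟦ sign j ◃ ∣ j ∣ ⟧
      ≡⟨ ≡.cong₂ (λ i j → ⟦ i ⟧ * ⟦ j ⟧) (ℤ.◃-inverse i) (ℤ.◃-inverse j) ⟩
    ⟦ i ⟧ * ⟦ j ⟧ ∎

  fromℤ-minus : ∀ i j → ⟦ i ℤ.- j ⟧ ≈ ⟦ i ⟧ - ⟦ j ⟧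
  fromℤ-minus i j = trans (fromℤ-+ i (ℤ.- j)) (+-congˡ (fromℤ-neg j))

  fromℤ-minor : ∀ a b c d → ⟦ a ℤ.* b ℤ.- c ℤ.* d ⟧ ≈ ⟦ a ⟧ * ⟦ b ⟧ - ⟦ c ⟧ * ⟦ d ⟧
  fromℤ-minor a b c d =
    trans (fromℤ-minus (a ℤ.* b) (c ℤ.* d)) (+-cong (fromℤ-* a b) (-‿cong (fromℤ-* c d)))

  fromℤ-morphism : ℤ.+-*-rawRing ACR.-Raw-AlmostCommutative⟶ ACR.fromCommutativeRing commRing
  fromℤ-morphism = record
    { ⟦_⟧    = ⟦_⟧
    ; +-homo = fromℤ-+
    ; *-homo = fromℤ-*
    ; -‿homo = fromℤ-neg
    ; 0-homo = refl
    ; 1-homo = +-identityʳ 1#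
    }

  open import Algebra.Solver.Ring ℤ.+-*-rawRing (ACR.fromCommutativeRing commRing) fromℤ-morphism
    (λ i j → Maybe.map (reflexive ∘ ≡.cong ⟦_⟧) (dec⇒maybe (i ℤ.≟ j)))
    using (solve; _:=_; _:+_; _:*_; _:-_; con)

  private
    module ≤ = IsTotalOrder isTotalOrder

    ≤-resp₂ : ∀ {x x′ y y′} → x ≈ x′ → y ≈ y′ → x ≤ y → x′ ≤ y′
    ≤-resp₂ x≈x′ y≈y′ = ≤.≲-respˡ-≈ x≈x′ ∘ ≤.≲-respʳ-≈ y≈y′

  0≤1 : 0# ≤ 1#
  0≤1 with ≤.total 0# 1#
  ... | inj₁ 0≤1 = 0≤1
  ... | inj₂ 1≤0 = ≤.≲-respʳ-≈ (trans (-1*x≈-x _) (-‿involutive 1#)) (*-nonneg 0≤-1 0≤-1)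
    where
    0≤-1 : 0# ≤ (- 1#)
    0≤-1 = ≤-resp₂ (-‿inverseʳ 1#) (+-identityˡ _) (+-mono-≤ (- 1#) 1≤0)

  1≤1+ : ∀ {x} → 0# ≤ x → 1# ≤ (1# + x)
  1≤1+ 0≤x = ≤-resp₂ (+-identityˡ _) (+-comm _ _) (+-mono-≤ 1# 0≤x)

  0≤fromℕ : ∀ m → 0# ≤ ⟦ + m ⟧
  0≤fromℕ ℕ.zero    = ≤.refl
  0≤fromℕ (ℕ.suc m) = ≤.trans 0≤1 (1≤1+ (0≤fromℕ m))

  fromℕ≉0 : ∀ m .{{_ : NonZero m}} → ¬ ⟦ + m ⟧ ≈ 0#
  fromℕ≉0 (ℕ.suc m) m≈0 = 0≉1 (≤.antisym 0≤1 (≤.≲-respʳ-≈ m≈0 (1≤1+ (0≤fromℕ m))))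

  *-cancelˡ : ∀ {x u v} → ¬ x ≈ 0# → x * u ≈ x * v → u ≈ v
  *-cancelˡ {x} {u} {v} x≉0 xu≈xv with inverse x x≉0
  ... | y , xy≈1 = begin
    u             ≈⟨ *-identityˡ u ⟨
    1# * u        ≈⟨ *-congʳ xy≈1 ⟨
    (x * y) * u   ≈⟨ solve 3 (λ x y u → (x :* y) :* u := y :* (x :* u)) refl x y u ⟩
    y * (x * u)   ≈⟨ *-congˡ xu≈xv ⟩
    y * (x * v)   ≈⟨ solve 3 (λ x y v → y :* (x :* v) := (x :* y) :* v) refl x y v ⟩
    (x * y) * v   ≈⟨ *-congʳ xy≈1 ⟩
    1# * v        ≈⟨ *-identityˡ v ⟩
    v             ∎

  ∑-cong : ∀ n {f g : Fin n → Carrier} → (∀ i → f i ≈ g i) → ∑ F n f ≈ ∑ F n g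
  ∑-cong ℕ.zero    f≈g = refl
  ∑-cong (ℕ.suc n) f≈g = +-cong (f≈g zero) (∑-cong n (f≈g ∘ suc))

  dot : ∀ {n} → (Fin n → ℤ) → (Fin n → Carrier) → Carrier
  dot {n} u x = ∑ F n (λ j → ⟦ u j ⟧ * x j)

  dot-scale : ∀ {n} a (u : Fin n → ℤ) x → dot u (λ j → a * x j) ≈ a * dot u x
  dot-scale {ℕ.zero}  a u x = sym (zeroʳ a)
  dot-scale {ℕ.suc n} a u x =
    trans (+-cong (x∙yz≈y∙xz _ a _) (dot-scale a (u ∘ suc) (x ∘ suc))) (sym (distribˡ a _ _))

  dot-combination : ∀ {n} a b (u v : Fin n → ℤ) x →
    dot (λ j → a ℤ.* u j ℤ.- b ℤ.* v j) x ≈ ⟦ a ⟧ * dot u x - ⟦ b ⟧ * dot v x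
  dot-combination {ℕ.zero} a b u v x =
    solve 2 (λ a b → con (+ 0) := a :* con (+ 0) :- b :* con (+ 0)) refl ⟦ a ⟧ ⟦ b ⟧
  dot-combination {ℕ.suc n} a b u v x = begin
    ⟦ a ℤ.* u zero ℤ.- b ℤ.* v zero ⟧ * x zero + dot (λ j → a ℤ.* u′ j ℤ.- b ℤ.* v′ j) x′
      ≈⟨ +-cong (*-congʳ (fromℤ-minor a (u zero) b (v zero))) (dot-combination a b u′ v′ x′) ⟩
    (⟦ a ⟧ * ⟦ u zero ⟧ - ⟦ b ⟧ * ⟦ v zero ⟧) * x zero + (⟦ a ⟧ * dot u′ x′ - ⟦ b ⟧ * dot v′ x′)
      ≈⟨ solve 7 (λ a b u v x U V → (a :* u :- b :* v) :* x :+ (a :* U :- b :* V)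
                                   := a :* (u :* x :+ U) :- b :* (v :* x :+ V))
               refl ⟦ a ⟧ ⟦ b ⟧ ⟦ u zero ⟧ ⟦ v zero ⟧ (x zero) (dot u′ x′) (dot v′ x′) ⟩
    ⟦ a ⟧ * dot u x - ⟦ b ⟧ * dot v x ∎
    where
    u′ = u ∘ suc
    v′ = v ∘ suc
    x′ = x ∘ suc

  fromℤ-dot : ∀ {n} (u v : Fin n → ℤ) → ⟦ sumℤ (λ j → u j ℤ.* v j) ⟧ ≈ dot u (⟦_⟧ ∘ v)
  fromℤ-dot {ℕ.zero}  u v = refl
  fromℤ-dot {ℕ.suc n} u v =
    trans (fromℤ-+ (u zero ℤ.* v zero) _)
          (+-cong (fromℤ-* (u zero) (v zero)) (fromℤ-dot (u ∘ suc) (v ∘ suc)))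

  record FractionMod (k : ℤ) {n} (r : Fin n → ℤ) (x : Fin n → Carrier) : Set ℓ₁ where
    field
      denominator   : ℤ
      numerator     : Fin n → ℤ
      denominator≡1 : denominator ≡ + 1 [mod k ]
      numerator≡r   : ∀ j → numerator j ≡ r j [mod k ]
      scaled        : ∀ j → ⟦ denominator ⟧ * x j ≈ ⟦ numerator j ⟧

  module _ {n} (M : Fin (ℕ.suc n) → Fin (ℕ.suc n) → ℤ) (r : Fin (ℕ.suc n) → ℤ)
           (x : Fin (ℕ.suc n) → Carrier) (Mx≈r : ∀ i → dot (M i) x ≈ ⟦ r i ⟧) where

    condense-equations : ∀ i → dot (condense M i) (x ∘ suc) ≈ ⟦ condenseRhs M r i ⟧
    condense-equations i = begin
      dot (condense M i) (x ∘ suc)                      ≈⟨ +-identityˡ _ ⟨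
      0# + dot (condense M i) (x ∘ suc)                 ≈⟨ +-congʳ leading-term≈0 ⟨
      dot (λ j → m ℤ.* M (suc i) j ℤ.- b ℤ.* M zero j) x
        ≈⟨ dot-combination m b (M (suc i)) (M zero) x ⟩
      ⟦ m ⟧ * dot (M (suc i)) x - ⟦ b ⟧ * dot (M zero) x
        ≈⟨ +-cong (*-congˡ (Mx≈r (suc i))) (-‿cong (*-congˡ (Mx≈r zero))) ⟩
      ⟦ m ⟧ * ⟦ r (suc i) ⟧ - ⟦ b ⟧ * ⟦ r zero ⟧        ≈⟨ fromℤ-minor m (r (suc i)) b (r zero) ⟨
      ⟦ condenseRhs M r i ⟧                             ∎
      where
      m = M zero zero
      b = M (suc i) zero
      leading-term≈0 : ⟦ m ℤ.* b ℤ.- b ℤ.* m ⟧ * x zero ≈ 0#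
      leading-term≈0 = begin
        ⟦ m ℤ.* b ℤ.- b ℤ.* m ⟧ * x zero ≡⟨ ≡.cong (λ t → ⟦ t ⟧ * x zero) (identity m b) ⟩
        0# * x zero                      ≈⟨ zeroˡ (x zero) ⟩
        0#                               ∎
        where
        identity : ∀ m b → m ℤ.* b ℤ.- b ℤ.* m ≡ + 0
        identity = ℤ-Solver.solve-∀

    back-substitution : ∀ d (p : Fin n → ℤ) → (∀ j → ⟦ d ⟧ * x (suc j) ≈ ⟦ p j ⟧) →
      ⟦ M zero zero ℤ.* d ⟧ * x zero ≈ ⟦ d ℤ.* r zero ℤ.- sumℤ (λ j → M zero (suc j) ℤ.* p j) ⟧
    back-substitution d p dx≈p = begin
      ⟦ m ℤ.* d ⟧ * x zero
        ≈⟨ *-congʳ (fromℤ-* m d) ⟩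
      (⟦ m ⟧ * ⟦ d ⟧) * x zero
        ≈⟨ solve 4 (λ m d x S → (m :* d) :* x := d :* (m :* x :+ S) :- d :* S)
                 refl ⟦ m ⟧ ⟦ d ⟧ (x zero) (dot u′ x′) ⟩
      ⟦ d ⟧ * dot (M zero) x - ⟦ d ⟧ * dot u′ x′
        ≈⟨ +-cong (*-congˡ (Mx≈r zero)) (-‿cong (sym (dot-scale ⟦ d ⟧ u′ x′))) ⟩
      ⟦ d ⟧ * ⟦ r zero ⟧ - dot u′ (λ j → ⟦ d ⟧ * x′ j)
        ≈⟨ +-congˡ (-‿cong (∑-cong n (λ j → *-congˡ (dx≈p j)))) ⟩
      ⟦ d ⟧ * ⟦ r zero ⟧ - dot u′ (⟦_⟧ ∘ p)
        ≈⟨ +-congˡ (-‿cong (fromℤ-dot u′ p)) ⟨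
      ⟦ d ⟧ * ⟦ r zero ⟧ - ⟦ sumℤ (λ j → u′ j ℤ.* p j) ⟧
        ≈⟨ trans (fromℤ-minus (d ℤ.* r zero) _) (+-congʳ (fromℤ-* d (r zero))) ⟨
      ⟦ d ℤ.* r zero ℤ.- sumℤ (λ j → u′ j ℤ.* p j) ⟧ ∎
      where
      m  = M zero zero
      u′ = M zero ∘ suc
      x′ = x ∘ suc

  uncondense : ∀ {k n} {M : Fin (ℕ.suc n) → Fin (ℕ.suc n) → ℤ} {r x} →
    (∀ i j → M i j ≡ δ i j [mod k ]) → (Mx≈r : ∀ i → dot (M i) x ≈ ⟦ r i ⟧) →
    FractionMod k (condenseRhs M r) (x ∘ suc) → FractionMod k r x
  uncondense {k} {n} {M} {r} {x} M≡I Mx≈r condensed = record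
    { denominator   = m ℤ.* d
    ; numerator     = p
    ; denominator≡1 = ≡-mod-trans (≡1⇒*≡ d (M≡I zero zero)) d≡1
    ; numerator≡r   = p≡r
    ; scaled        = md*x≈p
    }
    where
    open FractionMod condensed renaming
      ( denominator to d; numerator to p′; denominator≡1 to d≡1
      ; numerator≡r to p′≡r′; scaled to d*x′≈p′ )
    m = M zero zero

    p : Fin (ℕ.suc n) → ℤ
    p zero    = d ℤ.* r zero ℤ.- sumℤ (λ j → M zero (suc j) ℤ.* p′ j)
    p (suc j) = m ℤ.* p′ j

    p≡r : ∀ j → p j ≡ r j [mod k ]
    p≡r zero    = ≡-mod-trans (∣⇒-≡ _ (∣-sum _ λ j → ∣m⇒∣m*n (p′ j) (≡0⇒∣ (M≡I zero (suc j)))))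
                              (≡1⇒*≡ (r zero) d≡1)
    p≡r (suc j) = ≡-mod-trans (≡1⇒*≡ (p′ j) (M≡I zero zero))
                              (≡-mod-trans (p′≡r′ j) (condenseRhs-≡ M≡I r j))

    md*x≈p : ∀ j → ⟦ m ℤ.* d ⟧ * x j ≈ ⟦ p j ⟧
    md*x≈p zero    = back-substitution M r x Mx≈r d p′ d*x′≈p′
    md*x≈p (suc j) = begin
      ⟦ m ℤ.* d ⟧ * x (suc j)     ≈⟨ *-congʳ (fromℤ-* m d) ⟩
      (⟦ m ⟧ * ⟦ d ⟧) * x (suc j) ≈⟨ *-assoc _ _ _ ⟩
      ⟦ m ⟧ * (⟦ d ⟧ * x (suc j)) ≈⟨ *-congˡ (d*x′≈p′ j) ⟩
      ⟦ m ⟧ * ⟦ p′ j ⟧            ≈⟨ fromℤ-* m (p′ j) ⟨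
      ⟦ p (suc j) ⟧               ∎

  ≡δ⇒FractionMod : ∀ {k} n (M : Fin n → Fin n → ℤ) r x → (∀ i j → M i j ≡ δ i j [mod k ]) →
                   (∀ i → dot (M i) x ≈ ⟦ r i ⟧) → FractionMod k r x
  ≡δ⇒FractionMod ℕ.zero M r x _ _ = record
    { denominator = + 1 ; numerator = λ () ; denominator≡1 = ≡-mod-refl
    ; numerator≡r = λ () ; scaled = λ () }
  ≡δ⇒FractionMod (ℕ.suc n) M r x M≡I Mx≈r = uncondense M≡I Mx≈r
    (≡δ⇒FractionMod n (condense M) (condenseRhs M r) (x ∘ suc)
                    (condense-≡δ M≡I) (condense-equations M r x Mx≈r))

  OddFraction : Carrier → Set ℓ₁
  OddFraction y = Σ ℤ λ p → Σ ℕ λ q →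
    NonZero q × Coprime ∣ p ∣ q × y * ⟦ + q ⟧ ≈ ⟦ p ⟧ × ∣ p ∣ % 2 ≡ 1 × q % 2 ≡ 1

  oddFractionℕ : ∀ {y} D p → ¬ 2 ℕ.∣ D → ¬ 2 ℕ.∣ ∣ p ∣ → ⟦ + D ⟧ * y ≈ ⟦ p ⟧ → OddFraction y
  oddFractionℕ {y} D p odd-D odd-p Dy≈p =
    p′ , q , ¬∣⇒NonZero odd-q , coprime , yq≈p′ , odd⇒%2≡1 odd-p′ , odd⇒%2≡1 odd-q
    where
    g = gcd ∣ p ∣ D
    instance
      g≢0 : NonZero g
      g≢0 = ℕ.≢-nonZero (gcd[m,n]≢0 ∣ p ∣ D (inj₂ (ℕ.≢-nonZero⁻¹ D {{¬∣⇒NonZero odd-D}})))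
    q = D / g
    D≡q*g : D ≡ q ℕ.* g
    D≡q*g = ≡.sym (m/n*n≡m (gcd[m,n]∣n ∣ p ∣ D))
    open _∣_ (∣ᵤ⇒∣ {+ g} {p} (gcd[m,n]∣m ∣ p ∣ D)) renaming (quotient to p′; equality to p≡p′*g)
    ∣p∣≡∣p′∣*g : ∣ p ∣ ≡ ∣ p′ ∣ ℕ.* g
    ∣p∣≡∣p′∣*g = ≡.trans (≡.cong ∣_∣ p≡p′*g) (ℤ.abs-* p′ (+ g))
    coprime : Coprime ∣ p′ ∣ q
    coprime = ≡.subst (λ m → Coprime m q)
      (≡.trans (≡.cong (_/ g) ∣p∣≡∣p′∣*g) (m*n/n≡m ∣ p′ ∣ g)) (coprime-/gcd ∣ p ∣ D)
    odd-q : ¬ 2 ℕ.∣ q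
    odd-q = ¬∣m*n⇒¬∣m g (≡.subst (λ m → ¬ 2 ℕ.∣ m) D≡q*g odd-D)
    odd-p′ : ¬ 2 ℕ.∣ ∣ p′ ∣
    odd-p′ = ¬∣m*n⇒¬∣m g (≡.subst (λ m → ¬ 2 ℕ.∣ m) ∣p∣≡∣p′∣*g odd-p)
    yq≈p′ : y * ⟦ + q ⟧ ≈ ⟦ p′ ⟧
    yq≈p′ = *-cancelˡ (fromℕ≉0 g) (begin
      ⟦ + g ⟧ * (y * ⟦ + q ⟧)  ≈⟨ solve 3 (λ g y q → g :* (y :* q) := (q :* g) :* y)
                                          refl ⟦ + g ⟧ y ⟦ + q ⟧ ⟩
      (⟦ + q ⟧ * ⟦ + g ⟧) * y  ≈⟨ *-congʳ (fromℕ-* q g) ⟨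
      ⟦ + (q ℕ.* g) ⟧ * y      ≡⟨ ≡.cong (λ m → ⟦ + m ⟧ * y) D≡q*g ⟨
      ⟦ + D ⟧ * y              ≈⟨ Dy≈p ⟩
      ⟦ p ⟧                    ≡⟨ ≡.cong ⟦_⟧ p≡p′*g ⟩
      ⟦ p′ ℤ.* + g ⟧           ≈⟨ fromℤ-* p′ (+ g) ⟩
      ⟦ p′ ⟧ * ⟦ + g ⟧         ≈⟨ *-comm _ _ ⟩
      ⟦ + g ⟧ * ⟦ p′ ⟧         ∎)

  oddFraction : ∀ {y} d p → d ≡ + 1 [mod + 2 ] → p ≡ + 1 [mod + 2 ] →
                ⟦ d ⟧ * y ≈ ⟦ p ⟧ → OddFraction y
  oddFraction (+ D) p d≡1 p≡1 dy≈p =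
    oddFractionℕ D p (≡1-mod-2⇒odd d≡1) (≡1-mod-2⇒odd p≡1) dy≈p
  oddFraction {y} -[1+ D ] p d≡1 p≡1 dy≈p =
    oddFractionℕ (ℕ.suc D) (ℤ.- p) (≡1-mod-2⇒odd d≡1)
      (≡.subst (λ m → ¬ 2 ℕ.∣ m) (≡.sym (ℤ.∣-i∣≡∣i∣ p)) (≡1-mod-2⇒odd p≡1)) (begin
        ⟦ +[1+ D ] ⟧ * y       ≈⟨ -‿involutive _ ⟨
        - - (⟦ +[1+ D ] ⟧ * y) ≈⟨ -‿cong (trans (-‿distribˡ-* _ _) dy≈p) ⟩
        - ⟦ p ⟧                ≈⟨ fromℤ-neg p ⟨
        ⟦ ℤ.- p ⟧              ∎)

  fromℤ-payoffℤ : ∀ {n} beats (i j : Fin n) → ⟦ payoffℤ beats i j ⟧ ≈ payoff F beats i j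
  fromℤ-payoffℤ beats i j with i ≟ j
  ... | yes _ = +-identityʳ 1#
  ... | no  _ with beats i j
  ...   | true  = +-congˡ (+-identityʳ 1#)
  ...   | false = refl

  payoff-system : ∀ {n} beats (a : Fin n → Carrier) → (∀ j → cj F n beats a j ≈ 1#) →
                  ∀ i → dot (λ j → payoffℤ beats j i) a ≈ ⟦ + 1 ⟧
  payoff-system {n} beats a c≈1 i =
    trans (∑-cong n (λ j → *-congʳ (fromℤ-payoffℤ beats j i)))
          (trans (c≈1 i) (sym (+-identityʳ 1#)))

lemma2p5 : ∀ {c ℓ₁ ℓ₂} (F : OrderedField c ℓ₁ ℓ₂) (n : ℕ)
    (beats : Fin n → Fin n → Bool) → IsTournament n beats →
    (a : Fin n → OrderedField.Carrier F) →
    IsNash F n beats a →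
    (∀ j → OrderedField._≈_ F (cj F n beats a j) (OrderedField.1# F)) →
    ∀ j → Σ ℤ (λ p → Σ ℕ (λ q →
    NonZero q × Coprime ∣ p ∣ q ×
    OrderedField._≈_ F (OrderedField._*_ F (a j) (fromℤ F (+ q))) (fromℤ F p) ×
    (∣ p ∣ % 2 ≡ 1) × (q % 2 ≡ 1)))
lemma2p5 F n beats _ a _ c≈1 j =
  oddFraction F denominator (numerator j) denominator≡1 (numerator≡r j) (scaled j)
  where
  open FractionMod (≡δ⇒FractionMod F n (λ i j → payoffℤ beats j i) (λ _ → + 1) a
                    (payoffℤᵀ-≡δ beats) (payoff-system F beats a c≈1))
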